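{- Let $\mathcal{G}$ and $\mathcal{H}$ be two hypergraphs on vertex set $V$ such that $\mathcal{G}\subseteq tr(\mathcal{H})$ or $\mathcal{H}\subseteq tr(\mathcal{G})$. Then $|V|\le|\mathcal{G}|\cdot|\mathcal{H}|$.
   Context: Hypergraphs are identified with their edge sets; both are on the common vertex set $V$ and every vertex of $V$ belongs to at least one edge of each hypergraph. $tr(\mathcal{G})$ is the set of minimal transversals of $\mathcal{G}$ (inclusion-minimal subsets of $V$ meeting every edge). $|\mathcal{G}|$ is the number of edges of $\mathcal{G}$. -}

module Defs where

open import Data.Nat using (ℕ)
open import Data.Fin using (Fin)
open import Data.Fin.Subset using (Subset; _∈_; _⊂_; _⊆_)
open import Data.List using (List)
open import Data.List.Relation.Unary.All using (All)
open import Data.List.Relation.Unary.Any using (Any)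
open import Data.List.Relation.Unary.Unique.Propositional using (Unique)
open import Data.Product using (∃; _×_)
open import Relation.Nullary using (¬_)
import Data.List.Membership.Propositional as L

-- A hypergraph on the vertex set V = Fin n, identified with its edge set:
-- a duplicate-free list of subsets of V (so its length is the number of edges).
record Hypergraph (n : ℕ) : Set where
  constructor mkHypergraph
  field
    edges  : List (Subset n)
    unique : Unique edges

open Hypergraph public

Covers : ∀ {n} → Hypergraph n → Set
Covers {n} G = (v : Fin n) → Any (v ∈_) (edges G)

Meets : ∀ {n} → Subset n → Subset n → Set
Meets T E = ∃ λ v → v ∈ T × v ∈ E

IsTransversal : ∀ {n} → Hypergraph n → Subset n → Set
IsTransversal G T = All (Meets T) (edges G)

IsMinimalTransversal : ∀ {n} → Hypergraph n → Subset n → Set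
IsMinimalTransversal G T = IsTransversal G T × (∀ S → S ⊂ T → ¬ IsTransversal G S)

_⊆tr_ : ∀ {n} → Hypergraph n → Hypergraph n → Set
G ⊆tr H = All (IsMinimalTransversal H) (edges G)

∣_∣ₑ : ∀ {n} → Hypergraph n → ℕ
∣ G ∣ₑ = Data.List.length (edges G)

-- Choose for every vertex v an edge T of G through v. T is a minimal
-- transversal of H, so T - v is not a transversal: some edge E of H misses
-- T - v while meeting T, i.e. T ∩ E = {v}. Hence v is recovered from the pair
-- (T , E), and v ↦ (T , E) embeds V into G × H.
module Submission where

open import Defs
open import Data.Nat using (ℕ; _≤_; _*_)
open import Data.Nat.Properties using (*-comm)
open import Data.Fin using (Fin; combine)
open import Data.Fin.Properties using (any?; injective⇒≤; combine-injective; _≟_)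
open import Data.Fin.Subset using (Subset; _∈_; _-_)
open import Data.Fin.Subset.Properties using (_∈?_; x∈p⇒p-x⊂p; x∈p∧x≢y⇒x∈p-y)
open import Data.List using (List; lookup)
open import Data.List.Relation.Unary.All using (All; _∷_; lookupAny)
open import Data.List.Relation.Unary.All.Properties.Core using (¬All⇒Any¬)
open import Data.List.Relation.Unary.Any as Any using (Any; here; there)
open import Data.List.Relation.Unary.Any.Properties using (lookup-index)
open import Data.Product using (_×_; _,_; proj₁)
open import Data.Sum using (_⊎_; inj₁; inj₂)
open import Relation.Nullary using (¬_; Dec; yes; no; contradiction)
open import Relation.Nullary.Decidable using (_×-dec_)
open import Relation.Unary using (_∩_)
open import Relation.Binary.PropositionalEquality using (_≡_; sym; subst)

≤-*-by-injective-pair : ∀ {n a b} (i : Fin n → Fin a) (j : Fin n → Fin b) →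
                        (∀ {v w} → i v ≡ i w → j v ≡ j w → v ≡ w) → n ≤ a * b
≤-*-by-injective-pair i j inj = injective⇒≤ λ {v} {w} eq →
  let i≡ , j≡ = combine-injective (i v) (j v) (i w) (j w) eq in inj i≡ j≡

All∧Any⇒Any∩ : ∀ {A : Set} {P Q : A → Set} {xs : List A} →
               All P xs → Any Q xs → Any (P ∩ Q) xs
All∧Any⇒Any∩ (px ∷ _)  (here qx)  = here (px , qx)
All∧Any⇒Any∩ (_ ∷ pxs) (there qx) = there (All∧Any⇒Any∩ pxs qx)

meets? : ∀ {n} (T E : Subset n) → Dec (Meets T E)
meets? T E = any? λ v → (v ∈? T) ×-dec (v ∈? E)

MeetsOnlyAt : ∀ {n} → Subset n → Fin n → Subset n → Set
MeetsOnlyAt T v E = v ∈ E × (∀ {w} → w ∈ T → w ∈ E → w ≡ v)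

¬meets-minus⇒≡ : ∀ {n} {T E : Subset n} {v w} →
                 ¬ Meets (T - v) E → w ∈ T → w ∈ E → w ≡ v
¬meets-minus⇒≡ {v = v} {w} ¬meets w∈T w∈E with w ≟ v
... | yes w≡v = w≡v
... | no  w≢v = contradiction (w , x∈p∧x≢y⇒x∈p-y w∈T w≢v , w∈E) ¬meets

meets∧¬meets-minus⇒meetsOnlyAt : ∀ {n} {T E : Subset n} {v} →
                                 Meets T E → ¬ Meets (T - v) E → MeetsOnlyAt T v E
meets∧¬meets-minus⇒meetsOnlyAt (w , w∈T , w∈E) ¬meets =
  subst (_∈ _) (¬meets-minus⇒≡ ¬meets w∈T w∈E) w∈E , ¬meets-minus⇒≡ ¬meets

minimalTransversal⇒meetsOnlyAt : ∀ {n} (H : Hypergraph n) {T v} →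
                                 IsMinimalTransversal H T → v ∈ T →
                                 Any (MeetsOnlyAt T v) (edges H)
minimalTransversal⇒meetsOnlyAt H {T} {v} (transversal , minimal) v∈T =
  Any.map (λ (meets , ¬meets) → meets∧¬meets-minus⇒meetsOnlyAt meets ¬meets)
          (All∧Any⇒Any∩ transversal missed)
  where
  missed : Any (λ E → ¬ Meets (T - v) E) (edges H)
  missed = ¬All⇒Any¬ (meets? (T - v)) (edges H) (minimal (T - v) (x∈p⇒p-x⊂p v∈T))

module _ {n} (G H : Hypergraph n) (cover : Covers G) (G⊆trH : G ⊆tr H) where

  private
    edgeThrough : (v : Fin n) → Subset n
    edgeThrough v = Any.lookup (cover v)

    edgeThrough-minimal : (v : Fin n) → IsMinimalTransversal H (edgeThrough v)
    edgeThrough-minimal v = proj₁ (lookupAny G⊆trH (cover v))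

    privateEdgeAt : (v : Fin n) → Any (MeetsOnlyAt (edgeThrough v) v) (edges H)
    privateEdgeAt v =
      minimalTransversal⇒meetsOnlyAt H (edgeThrough-minimal v) (lookup-index (cover v))

    privateEdge : (v : Fin n) → Subset n
    privateEdge v = Any.lookup (privateEdgeAt v)

    determined : ∀ {v w} → Any.index (cover v) ≡ Any.index (cover w) →
                 Any.index (privateEdgeAt v) ≡ Any.index (privateEdgeAt w) → v ≡ w
    determined {v} {w} i≡ j≡
      with lookup-index (privateEdgeAt v) | lookup-index (privateEdgeAt w)
    ... | _ , only-v | w∈private-w , _ = sym (only-v w∈edge-v w∈private-v)
      where
      w∈edge-v : w ∈ edgeThrough v
      w∈edge-v = subst (λ i → w ∈ lookup (edges G) i) (sym i≡) (lookup-index (cover w))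
      w∈private-v : w ∈ privateEdge v
      w∈private-v = subst (λ j → w ∈ lookup (edges H) j) (sym j≡) w∈private-w

  ⊆tr⇒≤-* : n ≤ ∣ G ∣ₑ * ∣ H ∣ₑ
  ⊆tr⇒≤-* = ≤-*-by-injective-pair (λ v → Any.index (cover v))
                                   (λ v → Any.index (privateEdgeAt v)) determined

lemma31 : (n : ℕ) (G H : Hypergraph n) → Covers G → Covers H →
          (G ⊆tr H ⊎ H ⊆tr G) → n ≤ ∣ G ∣ₑ * ∣ H ∣ₑ
lemma31 n G H coverG coverH (inj₁ G⊆trH) = ⊆tr⇒≤-* G H coverG G⊆trH
lemma31 n G H coverG coverH (inj₂ H⊆trG) =
  subst (n ≤_) (*-comm ∣ H ∣ₑ ∣ G ∣ₑ) (⊆tr⇒≤-* H G coverH H⊆trG)
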